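{- Let $0<q<1$, let $B_{0,q},B_{1,q},\dots\in\mathbb{R}$ with $B_{0,q}\ne0$, and define $A_{0,q}(x)=1/B_{0,q}$ and, for $n\ge1$, $A_{n,q}(x)=\frac{(-1)^n}{B_{0,q}^{n+1}}\det N_n(x)$, where $N_n(x)$ is the $(n+1)\times(n+1)$ matrix with rows and columns indexed by $r,c\in\{0,\dots,n\}$, row $0$ equal to $(1,x,\dots,x^n)$, and entry in row $r\ge1$, column $c$ equal to $\left[\begin{smallmatrix} c\\ r-1\end{smallmatrix}\right]_qB_{c-r+1,q}$ if $c\ge r-1$ and $0$ otherwise. Then for every $n\ge1$, \[ x^n=\sum_{k=0}^{n}\left[\begin{smallmatrix} n\\ k\end{smallmatrix}\right]_qB_{n-k,q}A_{k,q}(x). \]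
   Context: $[n]_q=\frac{1-q^n}{1-q}$, $[n]_q!=[1]_q\cdots[n]_q$ with $[0]_q!=1$, and $\left[\begin{smallmatrix} n\\ k\end{smallmatrix}\right]_q=\frac{[n]_q!}{[k]_q![n-k]_q!}$. -}

module Defs where

open import Level using (Level; _⊔_) renaming (suc to lsuc)
open import Algebra.Bundles using (CommutativeRing)
open import Relation.Binary.Core using (Rel)
open import Relation.Binary.Structures using (IsStrictPartialOrder)
open import Relation.Nullary using (¬_; yes; no)
open import Data.Nat using (ℕ; zero; suc; _∸_; _≤?_)
open import Data.Fin using (Fin; zero; suc; toℕ; punchIn)

-- An ordered field: a commutative ring with a strict order compatible with
-- + and *, 0 < 1, and a (total) inverse operation that is a genuine inverse
-- on nonzero elements (the value at 0 is irrelevant).  ℝ is an instance.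
record OrderedField (c ℓ₁ ℓ₂ : Level) : Set (lsuc (c ⊔ ℓ₁ ⊔ ℓ₂)) where
  field
    commutativeRing : CommutativeRing c ℓ₁
  open CommutativeRing commutativeRing public
  infix 4 _<_
  infix 8 _⁻¹
  field
    _<_ : Rel Carrier ℓ₂
    isStrictPartialOrder : IsStrictPartialOrder _≈_ _<_
    +-mono-< : ∀ {a b} c → a < b → a + c < b + c
    *-pos : ∀ {a b} → 0# < a → 0# < b → 0# < a * b
    0<1 : 0# < 1#
    _⁻¹ : Carrier → Carrier
    ⁻¹-inverse : ∀ x → ¬ (x ≈ 0#) → x * x ⁻¹ ≈ 1#

module _ {c ℓ₁ ℓ₂ : Level} (F : OrderedField c ℓ₁ ℓ₂) where
  open OrderedField F using (Carrier; _+_; _*_; -_; 0#; 1#; _⁻¹)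

  pow : Carrier → ℕ → Carrier
  pow x zero    = 1#
  pow x (suc n) = x * pow x n

  qInt : Carrier → ℕ → Carrier
  qInt q n = (1# + - pow q n) * (1# + - q) ⁻¹

  qFact : Carrier → ℕ → Carrier
  qFact q zero    = 1#
  qFact q (suc n) = qFact q n * qInt q (suc n)

  qBinom : Carrier → ℕ → ℕ → Carrier
  qBinom q n k = qFact q n * (qFact q k * qFact q (n ∸ k)) ⁻¹

  sumFin : (n : ℕ) → (Fin n → Carrier) → Carrier
  sumFin zero    f = 0#
  sumFin (suc n) f = f zero + sumFin n (λ i → f (suc i))

  det : (n : ℕ) → (Fin n → Fin n → Carrier) → Carrier
  det zero    M = 1#
  det (suc n) M = sumFin (suc n) (λ j →
    pow (- 1#) (toℕ j) * (M zero j * det n (λ r c → M (suc r) (punchIn j c))))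

  NMat : Carrier → (ℕ → Carrier) → Carrier → (n : ℕ) → Fin (suc n) → Fin (suc n) → Carrier
  NMat q B x n zero    c = pow x (toℕ c)
  NMat q B x n (suc r) c with toℕ r ≤? toℕ c
  ... | yes _ = qBinom q (toℕ c) (toℕ r) * B (toℕ c ∸ toℕ r)
  ... | no  _ = 0#

  Apoly : Carrier → (ℕ → Carrier) → Carrier → ℕ → Carrier
  Apoly q B x zero    = (B 0) ⁻¹
  Apoly q B x (suc n) =
    pow (- 1#) (suc n) * (det (suc (suc n)) (NMat q B x (suc n)) * (pow (B 0) (suc (suc n))) ⁻¹)

{-# OPTIONS --safe #-}
module Submission where

open import Defs
open import Level using (Level)
open import Relation.Nullary using (¬_; yes; no)
open import Relation.Binary.PropositionalEquality as ≡ using (_≡_; _≢_)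
open import Relation.Binary.Structures using (IsStrictPartialOrder)
open import Relation.Binary.Definitions using (tri<; tri≈; tri>)
open import Data.Nat as ℕ using (ℕ; zero; suc; _∸_; _≤_; z≤n; s≤s; z<s; _≤?_)
open import Data.Nat.Properties as ℕ using ()
open import Data.Nat.Induction using (<-rec)
open import Data.Fin using (Fin; zero; suc; toℕ; punchIn)
open import Data.Fin.Properties using (toℕ<n)
open import Data.Product using (_,_)
open import Data.Empty using (⊥-elim)
open import Function using (_∘_)
import Algebra.Properties.Ring as RingProperties
import Algebra.Properties.Group as GroupProperties
import Algebra.Properties.CommutativeSemigroup as CommutativeSemigroupProperties
import Algebra.Properties.Semiring.Sum as SemiringSum
import Algebra.Solver.CommutativeMonoid as CommutativeMonoidSolver
import Relation.Binary.Reasoning.Setoid as SetoidReasoning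

-- Let R be the upper triangular matrix with R r c = [c r]_q B_{c−r} for r ≤ c; its
-- diagonal is B_0 ≠ 0, and N_k(x) is the row (1, x, …, x^k) on top of the first k rows
-- of R.  Expanding det N_k(x) along that row, every minor is block triangular, so
-- A_k(x) = (−1)^k B_0^{−k−1} Σ_j x^j Y j k, where Y j k = (−1)^j B_0^j times the
-- determinant of rows j … k−1 and columns j+1 … k of R.  Expanding that determinant
-- along its first row shows that R Y is diagonal with (R Y) k k = (−1)^k B_0^{k+1}.
-- Hence, for the row vectors a = (A_k(x))_k and p = (x^n)_n, a R Y = p Y; since Y is
-- triangular with nonzero diagonal, a R = p, which is the identity.

module OrderedFieldProperties {c ℓ₁ ℓ₂ : Level} (F : OrderedField c ℓ₁ ℓ₂) where
  open OrderedField F hiding (zero) renaming (_<_ to _<ᶠ_)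
  open IsStrictPartialOrder isStrictPartialOrder
    using (irrefl; <-respˡ-≈; <-respʳ-≈) renaming (trans to <-trans)
  open RingProperties ring using (-‿involutive; -1*x≈-x)
  open CommutativeMonoidSolver *-commutativeMonoid using (solve; _⊜_; _⊕_)
  open SetoidReasoning setoid

  infixr 8 _^_
  _^_ : Carrier → ℕ → Carrier
  x ^ n = pow F x n

  ^-homo-* : ∀ x m n → x ^ (m ℕ.+ n) ≈ x ^ m * x ^ n
  ^-homo-* x zero    n = sym (*-identityˡ _)
  ^-homo-* x (suc m) n = trans (*-congˡ (^-homo-* x m n)) (sym (*-assoc _ _ _))

  -1*-1≈1 : - 1# * - 1# ≈ 1#
  -1*-1≈1 = trans (-1*x≈-x (- 1#)) (-‿involutive 1#)

  [-1]^n*[-1]^n≈1 : ∀ n → (- 1#) ^ n * (- 1#) ^ n ≈ 1#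
  [-1]^n*[-1]^n≈1 zero    = *-identityˡ 1#
  [-1]^n*[-1]^n≈1 (suc n) = begin
    (- 1# * σ) * (- 1# * σ)
      ≈⟨ solve 2 (λ m σ → (m ⊕ σ) ⊕ (m ⊕ σ) ⊜ (m ⊕ m) ⊕ (σ ⊕ σ)) refl (- 1#) σ ⟩
    (- 1# * - 1#) * (σ * σ)
      ≈⟨ *-cong -1*-1≈1 ([-1]^n*[-1]^n≈1 n) ⟩
    1# * 1#
      ≈⟨ *-identityˡ 1# ⟩
    1#
      ∎
    where σ = (- 1#) ^ n

  0<x⇒x≉0 : ∀ {x} → 0# <ᶠ x → ¬ (x ≈ 0#)
  0<x⇒x≉0 0<x x≈0 = irrefl (sym x≈0) 0<x

  1≉0 : ¬ (1# ≈ 0#)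
  1≉0 = 0<x⇒x≉0 0<1

  x*y≈0⇒x≈0 : ∀ {x y} → ¬ (y ≈ 0#) → x * y ≈ 0# → x ≈ 0#
  x*y≈0⇒x≈0 {x} {y} y≉0 xy≈0 = begin
    x                ≈⟨ *-identityʳ x ⟨
    x * 1#           ≈⟨ *-congˡ (⁻¹-inverse y y≉0) ⟨
    x * (y * y ⁻¹)   ≈⟨ *-assoc x y (y ⁻¹) ⟨
    (x * y) * y ⁻¹   ≈⟨ *-congʳ xy≈0 ⟩
    0# * y ⁻¹        ≈⟨ zeroˡ (y ⁻¹) ⟩
    0#               ∎

  x≉0∧y≉0⇒xy≉0 : ∀ {x y} → ¬ (x ≈ 0#) → ¬ (y ≈ 0#) → ¬ (x * y ≈ 0#)
  x≉0∧y≉0⇒xy≉0 x≉0 y≉0 xy≈0 = x≉0 (x*y≈0⇒x≈0 y≉0 xy≈0)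

  x⁻¹≉0 : ∀ {x} → ¬ (x ≈ 0#) → ¬ (x ⁻¹ ≈ 0#)
  x⁻¹≉0 {x} x≉0 x⁻¹≈0 = 1≉0 (begin
    1#         ≈⟨ ⁻¹-inverse x x≉0 ⟨
    x * x ⁻¹   ≈⟨ *-congˡ x⁻¹≈0 ⟩
    x * 0#     ≈⟨ zeroʳ x ⟩
    0#         ∎)

  -- _⁻¹ is not assumed to respect ≈; it does at nonzero points, by uniqueness of inverses.
  ⁻¹-cong : ∀ {x y} → ¬ (y ≈ 0#) → x ≈ y → x ⁻¹ ≈ y ⁻¹
  ⁻¹-cong {x} {y} y≉0 x≈y = begin
    x ⁻¹               ≈⟨ *-identityʳ (x ⁻¹) ⟨
    x ⁻¹ * 1#          ≈⟨ *-congˡ (⁻¹-inverse y y≉0) ⟨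
    x ⁻¹ * (y * y ⁻¹)  ≈⟨ *-assoc (x ⁻¹) y (y ⁻¹) ⟨
    (x ⁻¹ * y) * y ⁻¹  ≈⟨ *-congʳ x⁻¹y≈1 ⟩
    1# * y ⁻¹          ≈⟨ *-identityˡ (y ⁻¹) ⟩
    y ⁻¹               ∎
    where
    x≉0 : ¬ (x ≈ 0#)
    x≉0 x≈0 = y≉0 (trans (sym x≈y) x≈0)
    x⁻¹y≈1 : x ⁻¹ * y ≈ 1#
    x⁻¹y≈1 = trans (*-comm (x ⁻¹) y) (trans (*-congʳ (sym x≈y)) (⁻¹-inverse x x≉0))

  x^n≉0 : ∀ {x} → ¬ (x ≈ 0#) → ∀ n → ¬ (x ^ n ≈ 0#)
  x^n≉0 x≉0 zero    = 1≉0
  x^n≉0 x≉0 (suc n) = x≉0∧y≉0⇒xy≉0 x≉0 (x^n≉0 x≉0 n)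

  [-1]^n≉0 : ∀ n → ¬ ((- 1#) ^ n ≈ 0#)
  [-1]^n≉0 n σ≈0 = 1≉0 (trans (sym ([-1]^n*[-1]^n≈1 n)) (trans (*-congʳ σ≈0) (zeroˡ _)))

  x<y⇒0<y-x : ∀ {x y} → x <ᶠ y → 0# <ᶠ y + - x
  x<y⇒0<y-x {x} x<y = <-respˡ-≈ (-‿inverseʳ x) (+-mono-< (- x) x<y)

  *-monoˡ-< : ∀ {x y z} → 0# <ᶠ z → x <ᶠ y → z * x <ᶠ z * y
  *-monoˡ-< {x} {y} {z} 0<z x<y =
    <-respʳ-≈ z[y-x]+zx≈zy (<-respˡ-≈ (+-identityˡ (z * x)) (+-mono-< (z * x) (*-pos 0<z (x<y⇒0<y-x x<y))))
    where
    z[y-x]+zx≈zy : z * (y + - x) + z * x ≈ z * y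
    z[y-x]+zx≈zy = begin
      z * (y + - x) + z * x   ≈⟨ distribˡ z (y + - x) x ⟨
      z * ((y + - x) + x)     ≈⟨ *-congˡ (+-assoc y (- x) x) ⟩
      z * (y + (- x + x))     ≈⟨ *-congˡ (+-congˡ (-‿inverseˡ x)) ⟩
      z * (y + 0#)            ≈⟨ *-congˡ (+-identityʳ y) ⟩
      z * y                   ∎

  x^[1+n]<1 : ∀ {x} → 0# <ᶠ x → x <ᶠ 1# → ∀ n → x ^ suc n <ᶠ 1#
  x^[1+n]<1 {x} 0<x x<1 zero    = <-respˡ-≈ (sym (*-identityʳ x)) x<1
  x^[1+n]<1 {x} 0<x x<1 (suc n) =
    <-trans (<-respʳ-≈ (*-identityʳ x) (*-monoˡ-< 0<x (x^[1+n]<1 0<x x<1 n))) x<1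

  module _ {q : Carrier} (0<q : 0# <ᶠ q) (q<1 : q <ᶠ 1#) where

    qInt[1+n]≉0 : ∀ n → ¬ (qInt F q (suc n) ≈ 0#)
    qInt[1+n]≉0 n = x≉0∧y≉0⇒xy≉0 (0<x⇒x≉0 (x<y⇒0<y-x (x^[1+n]<1 0<q q<1 n)))
                                  (x⁻¹≉0 (0<x⇒x≉0 (x<y⇒0<y-x q<1)))

    qFact≉0 : ∀ n → ¬ (qFact F q n ≈ 0#)
    qFact≉0 zero    = 1≉0
    qFact≉0 (suc n) = x≉0∧y≉0⇒xy≉0 (qFact≉0 n) (qInt[1+n]≉0 n)

    qBinom-diag : ∀ n → qBinom F q n n ≈ 1#
    qBinom-diag n = begin
      [n]! * ([n]! * qFact F q (n ∸ n)) ⁻¹   ≈⟨ *-congˡ (⁻¹-cong (qFact≉0 n) [n]!*[n-n]!≈[n]!) ⟩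
      [n]! * [n]! ⁻¹                         ≈⟨ ⁻¹-inverse [n]! (qFact≉0 n) ⟩
      1#                                     ∎
      where
      [n]! = qFact F q n
      [n]!*[n-n]!≈[n]! : [n]! * qFact F q (n ∸ n) ≈ [n]!
      [n]!*[n-n]!≈[n]! = trans (*-congˡ (reflexive (≡.cong (qFact F q) (ℕ.n∸n≡0 n)))) (*-identityʳ [n]!)

module UpperTriangularSystems {c ℓ₁ ℓ₂ : Level} (F : OrderedField c ℓ₁ ℓ₂) where
  open OrderedField F hiding (zero) renaming (_<_ to _<ᶠ_)
  open import Data.Nat.Base using (_<_)
  open OrderedFieldProperties F
  open RingProperties ring using (-‿distribˡ-*; -1*x≈-x)
  open GroupProperties +-group using (x∙y⁻¹≈ε⇒x≈y)
  open CommutativeSemigroupProperties *-commutativeSemigroup using (x∙yz≈y∙xz)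
  open SemiringSum semiring
    using (sum; sum-cong-≋; sum-replicate-zero; ∑-comm; ∑-distrib-+; *-distribˡ-sum; *-distribʳ-sum)
  open CommutativeMonoidSolver *-commutativeMonoid using (solve; _⊜_; _⊕_)
  open SetoidReasoning setoid

  sumFin≡sum : ∀ n (f : Fin n → Carrier) → sumFin F n f ≡ sum f
  sumFin≡sum zero    f = ≡.refl
  sumFin≡sum (suc n) f = ≡.cong (f zero +_) (sumFin≡sum n (λ i → f (suc i)))

  sumFin-cong : ∀ n {f g : Fin n → Carrier} → (∀ i → f i ≈ g i) → sumFin F n f ≈ sumFin F n g
  sumFin-cong zero    f≈g = refl
  sumFin-cong (suc n) f≈g = +-cong (f≈g zero) (sumFin-cong n (λ i → f≈g (suc i)))

  sumℕ : ℕ → (ℕ → Carrier) → Carrier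
  sumℕ n f = sum (λ (i : Fin n) → f (toℕ i))

  sumℕ-cong : ∀ n {f g : ℕ → Carrier} → (∀ i → i < n → f i ≈ g i) → sumℕ n f ≈ sumℕ n g
  sumℕ-cong n f≈g = sum-cong-≋ (λ i → f≈g (toℕ i) (toℕ<n i))

  sumℕ-zero : ∀ n {f : ℕ → Carrier} → (∀ i → i < n → f i ≈ 0#) → sumℕ n f ≈ 0#
  sumℕ-zero n f≈0 = trans (sumℕ-cong n f≈0) (sum-replicate-zero n)

  sumℕ-single : ∀ n {f : ℕ → Carrier} i → i < n → (∀ j → j < n → j ≢ i → f j ≈ 0#) → sumℕ n f ≈ f i
  sumℕ-single (suc n) {f} zero    _         f≈0 = begin
    f 0 + sumℕ n (λ j → f (suc j))   ≈⟨ +-congˡ (sumℕ-zero n (λ j j<n → f≈0 (suc j) (s≤s j<n) (λ ()))) ⟩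
    f 0 + 0#                         ≈⟨ +-identityʳ (f 0) ⟩
    f 0                              ∎
  sumℕ-single (suc n) {f} (suc i) (s≤s i<n) f≈0 = begin
    f 0 + sumℕ n (λ j → f (suc j))   ≈⟨ +-cong (f≈0 0 z<s (λ ())) (sumℕ-single n i i<n f∘suc≈0) ⟩
    0# + f (suc i)                   ≈⟨ +-identityˡ (f (suc i)) ⟩
    f (suc i)                        ∎
    where
    f∘suc≈0 : ∀ j → j < n → j ≢ i → f (suc j) ≈ 0#
    f∘suc≈0 j j<n j≢i = f≈0 (suc j) (s≤s j<n) (λ eq → j≢i (ℕ.suc-injective eq))

  sumℕ-window : ∀ a w n {f : ℕ → Carrier} → a ℕ.+ w ≤ n →
                (∀ i → i < a → f i ≈ 0#) → (∀ i → a ℕ.+ w ≤ i → f i ≈ 0#) →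
                sumℕ n f ≈ sumℕ w (λ i → f (a ℕ.+ i))
  sumℕ-window zero    zero    n       _         _    f≈0ʳ = sumℕ-zero n (λ i _ → f≈0ʳ i z≤n)
  sumℕ-window zero    (suc w) (suc n) (s≤s w≤n) _    f≈0ʳ =
    +-congˡ (sumℕ-window zero w n w≤n (λ _ ()) (λ i w≤i → f≈0ʳ (suc i) (s≤s w≤i)))
  sumℕ-window (suc a) w       (suc n) {f} (s≤s a+w≤n) f≈0ˡ f≈0ʳ = begin
    f 0 + sumℕ n (λ i → f (suc i))
      ≈⟨ +-cong (f≈0ˡ 0 z<s) (sumℕ-window a w n a+w≤n (λ i i<a → f≈0ˡ (suc i) (s≤s i<a))
                                                     (λ i a+w≤i → f≈0ʳ (suc i) (s≤s a+w≤i))) ⟩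
    0# + sumℕ w (λ i → f (suc a ℕ.+ i))
      ≈⟨ +-identityˡ _ ⟩
    sumℕ w (λ i → f (suc a ℕ.+ i))
      ∎

  sumℕ-distrib-minus : ∀ n (f g : ℕ → Carrier) → sumℕ n (λ i → f i + - g i) ≈ sumℕ n f + - sumℕ n g
  sumℕ-distrib-minus n f g = begin
    sumℕ n (λ i → f i + - g i)             ≈⟨ ∑-distrib-+ {n} (f ∘ toℕ) (λ i → - g (toℕ i)) ⟩
    sumℕ n f + sumℕ n (λ i → - g i)        ≈⟨ +-congˡ (sum-cong-≋ {n} (λ i → sym (-1*x≈-x (g (toℕ i))))) ⟩
    sumℕ n f + sumℕ n (λ i → - 1# * g i)   ≈⟨ +-congˡ (*-distribˡ-sum {n} (- 1#) (g ∘ toℕ)) ⟨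
    sumℕ n f + - 1# * sumℕ n g             ≈⟨ +-congˡ (-1*x≈-x (sumℕ n g)) ⟩
    sumℕ n f + - sumℕ n g                  ∎

  Matrix : Set c
  Matrix = ℕ → ℕ → Carrier

  vecMul : ℕ → (ℕ → Carrier) → Matrix → ℕ → Carrier
  vecMul N u A k = sumℕ (suc N) (λ n → u n * A n k)

  matMul : ℕ → Matrix → Matrix → Matrix
  matMul N A B i k = sumℕ (suc N) (λ l → A i l * B l k)

  vecMul-assoc : ∀ N u A B k → vecMul N (vecMul N u A) B k ≈ vecMul N u (matMul N A B) k
  vecMul-assoc N u A B k = begin
    sumℕ (suc N) (λ n → sumℕ (suc N) (λ l → u l * A l n) * B n k)
      ≈⟨ sumℕ-cong (suc N) (λ n _ → trans (*-distribʳ-sum {suc N} (B n k) (λ l → u (toℕ l) * A (toℕ l) n))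
                                          (sum-cong-≋ {suc N} (λ l → *-assoc (u (toℕ l)) (A (toℕ l) n) (B n k)))) ⟩
    sumℕ (suc N) (λ n → sumℕ (suc N) (λ l → u l * (A l n * B n k)))
      ≈⟨ ∑-comm {suc N} {suc N} (λ n l → u (toℕ l) * (A (toℕ l) (toℕ n) * B (toℕ n) k)) ⟩
    sumℕ (suc N) (λ l → sumℕ (suc N) (λ n → u l * (A l n * B n k)))
      ≈⟨ sumℕ-cong (suc N) (λ l _ → sym (*-distribˡ-sum {suc N} (u l) (λ n → A l (toℕ n) * B (toℕ n) k))) ⟩
    sumℕ (suc N) (λ l → u l * matMul N A B l k)
      ∎

  UpperTriangular : Matrix → Set ℓ₁
  UpperTriangular M = ∀ {i j} → j < i → M i j ≈ 0#

  record IsUpperTriangular (d : Carrier) (M : Matrix) : Set ℓ₁ where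
    field
      upper    : UpperTriangular M
      diagonal : ∀ i → M i i ≈ d

  module _ (N : ℕ) {T : Matrix} (T-triangular : UpperTriangular T) (T-diagonal≉0 : ∀ m → ¬ (T m m ≈ 0#)) where

    uT≈0⇒u≈0 : ∀ u → (∀ m → m ≤ N → vecMul N u T m ≈ 0#) → ∀ m → m ≤ N → u m ≈ 0#
    uT≈0⇒u≈0 u uT≈0 = <-rec (λ m → m ≤ N → u m ≈ 0#) step
      where
      step : ∀ m → (∀ {k} → k < m → k ≤ N → u k ≈ 0#) → m ≤ N → u m ≈ 0#
      step m u<m≈0 m≤N = x*y≈0⇒x≈0 (T-diagonal≉0 m)
        (trans (sym (sumℕ-single (suc N) {λ n → u n * T n m} m (s≤s m≤N) off-diagonal)) (uT≈0 m m≤N))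
        where
        off-diagonal : ∀ n → n < suc N → n ≢ m → u n * T n m ≈ 0#
        off-diagonal n n<1+N n≢m with ℕ.<-cmp n m
        ... | tri< n<m _ _ = trans (*-congʳ (u<m≈0 n<m (ℕ.≤-pred n<1+N))) (zeroˡ (T n m))
        ... | tri≈ _ n≡m _ = ⊥-elim (n≢m n≡m)
        ... | tri> _ _ m<n = trans (*-congˡ (T-triangular m<n)) (zeroʳ (u n))

    uT≈vT⇒u≈v : ∀ u v → (∀ m → m ≤ N → vecMul N u T m ≈ vecMul N v T m) → ∀ m → m ≤ N → u m ≈ v m
    uT≈vT⇒u≈v u v uT≈vT m m≤N = x∙y⁻¹≈ε⇒x≈y (u m) (v m) u-v≈0
      where
      [u-v]T≈0 : ∀ m → m ≤ N → vecMul N (λ n → u n + - v n) T m ≈ 0#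
      [u-v]T≈0 m m≤N = begin
        sumℕ (suc N) (λ n → (u n + - v n) * T n m)
          ≈⟨ sumℕ-cong (suc N) (λ n _ → trans (distribʳ (T n m) (u n) (- v n))
                                              (+-congˡ (sym (-‿distribˡ-* (v n) (T n m))))) ⟩
        sumℕ (suc N) (λ n → u n * T n m + - (v n * T n m))
          ≈⟨ sumℕ-distrib-minus (suc N) (λ n → u n * T n m) (λ n → v n * T n m) ⟩
        vecMul N u T m + - vecMul N v T m
          ≈⟨ +-congʳ (uT≈vT m m≤N) ⟩
        vecMul N v T m + - vecMul N v T m
          ≈⟨ -‿inverseʳ _ ⟩
        0#
          ∎
      u-v≈0 : u m + - v m ≈ 0#
      u-v≈0 = uT≈0⇒u≈0 (λ n → u n + - v n) [u-v]T≈0 m m≤N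

  det-cong : ∀ n {A B : Fin n → Fin n → Carrier} → (∀ i j → A i j ≈ B i j) → det F n A ≈ det F n B
  det-cong zero    A≈B = refl
  det-cong (suc n) {A} {B} A≈B = sumFin-cong (suc n) {expansion A} {expansion B} (λ j →
    *-congˡ (*-cong (A≈B zero j) (det-cong n (λ r c → A≈B (suc r) (punchIn j c)))))
    where
    expansion : (Fin (suc n) → Fin (suc n) → Carrier) → Fin (suc n) → Carrier
    expansion M j = (- 1#) ^ toℕ j * (M zero j * det F n (λ r c → M (suc r) (punchIn j c)))

  leadingMinor : ℕ → Matrix → Carrier
  leadingMinor n M = det F n (λ i j → M (toℕ i) (toℕ j))

  leadingMinor-cong : ∀ n {M M′ : Matrix} → (∀ i j → M i j ≈ M′ i j) → leadingMinor n M ≈ leadingMinor n M′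
  leadingMinor-cong n M≈M′ = det-cong n (λ i j → M≈M′ (toℕ i) (toℕ j))

  punchInℕ : ℕ → ℕ → ℕ
  punchInℕ zero    j       = suc j
  punchInℕ (suc i) zero    = zero
  punchInℕ (suc i) (suc j) = suc (punchInℕ i j)

  toℕ-punchIn : ∀ {n} (i : Fin (suc n)) (j : Fin n) → toℕ (punchIn i j) ≡ punchInℕ (toℕ i) (toℕ j)
  toℕ-punchIn zero    j       = ≡.refl
  toℕ-punchIn (suc i) zero    = ≡.refl
  toℕ-punchIn (suc i) (suc j) = ≡.cong suc (toℕ-punchIn i j)

  leadingMinor-expand : ∀ m (M : Matrix) → leadingMinor (suc m) M ≈
    sumℕ (suc m) (λ j → (- 1#) ^ j * (M 0 j * leadingMinor m (λ r c → M (suc r) (punchInℕ j c))))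
  leadingMinor-expand m M = trans (reflexive (sumFin≡sum (suc m) expansionFin))
    (sum-cong-≋ {suc m} {expansionFin} {expansionℕ ∘ toℕ} (λ j →
      *-congˡ (*-congˡ (det-cong m (λ r c → reflexive (≡.cong (M (suc (toℕ r))) (toℕ-punchIn j c)))))))
    where
    expansionFin : Fin (suc m) → Carrier
    expansionFin j = (- 1#) ^ toℕ j * (M 0 (toℕ j) * det F m (λ r c → M (suc (toℕ r)) (toℕ (punchIn j c))))
    expansionℕ : ℕ → Carrier
    expansionℕ j = (- 1#) ^ j * (M 0 j * leadingMinor m (λ r c → M (suc r) (punchInℕ j c)))

  leadingMinor-zeroColumn : ∀ m (M : Matrix) → 0 < m → (∀ r → M r 0 ≈ 0#) → leadingMinor m M ≈ 0#
  leadingMinor-zeroColumn (suc m) M _ M·0≈0 = trans (leadingMinor-expand m M) (sumℕ-zero (suc m) {term} term≈0)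
    where
    term : ℕ → Carrier
    term j = (- 1#) ^ j * (M 0 j * leadingMinor m (λ r c → M (suc r) (punchInℕ j c)))
    term≈0 : ∀ j → j < suc m → term j ≈ 0#
    term≈0 zero    _         = trans (*-congˡ (trans (*-congʳ (M·0≈0 0)) (zeroˡ _))) (zeroʳ _)
    term≈0 (suc j) (s≤s j<m) = trans (*-congˡ (trans (*-congˡ minor≈0) (zeroʳ _))) (zeroʳ _)
      where
      minor : Matrix
      minor r c = M (suc r) (punchInℕ (suc j) c)
      minor≈0 : leadingMinor m minor ≈ 0#
      minor≈0 = leadingMinor-zeroColumn m minor (ℕ.≤-trans z<s j<m) (λ r → M·0≈0 (suc r))

  shift : ℕ → Matrix → Matrix
  shift a M i j = M (a ℕ.+ i) (a ℕ.+ j)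

  shift-isUpperTriangular : ∀ {d M} a → IsUpperTriangular d M → IsUpperTriangular d (shift a M)
  shift-isUpperTriangular a M-triangular = record
    { upper    = λ j<i → upper (ℕ.+-monoʳ-< a j<i)
    ; diagonal = λ i → diagonal (a ℕ.+ i)
    }
    where open IsUpperTriangular M-triangular

  blockMinor : Matrix → ℕ → ℕ → Carrier
  blockMinor M j k = leadingMinor (k ∸ j) (λ r c → M (j ℕ.+ r) (suc (j ℕ.+ c)))

  blockMinor-diagonal : ∀ M k → blockMinor M k k ≈ 1#
  blockMinor-diagonal M k =
    reflexive (≡.cong (λ n → leadingMinor n (λ r c → M (k ℕ.+ r) (suc (k ℕ.+ c)))) (ℕ.n∸n≡0 k))

  blockMinor-shift : ∀ a M i m → blockMinor (shift a M) i m ≈ blockMinor M (a ℕ.+ i) (a ℕ.+ m)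
  blockMinor-shift a M i m = begin
    leadingMinor (m ∸ i) (λ r c → M (a ℕ.+ (i ℕ.+ r)) (a ℕ.+ suc (i ℕ.+ c)))
      ≈⟨ leadingMinor-cong (m ∸ i) (λ r c →
           reflexive (≡.cong₂ M (≡.sym (ℕ.+-assoc a i r)) (a+[1+i+c]≡1+a+i+c c))) ⟩
    leadingMinor (m ∸ i) M′
      ≡⟨ ≡.cong (λ n → leadingMinor n M′) (ℕ.[m+n]∸[m+o]≡n∸o a m i) ⟨
    leadingMinor (a ℕ.+ m ∸ (a ℕ.+ i)) M′
      ∎
    where
    M′ : Matrix
    M′ r c = M (a ℕ.+ i ℕ.+ r) (suc (a ℕ.+ i ℕ.+ c))
    a+[1+i+c]≡1+a+i+c : ∀ c → a ℕ.+ suc (i ℕ.+ c) ≡ suc (a ℕ.+ i ℕ.+ c)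
    a+[1+i+c]≡1+a+i+c c = ≡.trans (ℕ.+-suc a (i ℕ.+ c)) (≡.cong suc (≡.sym (ℕ.+-assoc a i c)))

  leadingMinor-deleteColumn : ∀ {d} M → IsUpperTriangular d M → ∀ i m → i ≤ m →
    leadingMinor m (λ r c → M r (punchInℕ i c)) ≈ d ^ i * blockMinor M i m
  leadingMinor-deleteColumn M _ zero m _ = sym (*-identityˡ _)
  leadingMinor-deleteColumn {d} M M-triangular (suc i) (suc m) (s≤s i≤m) = begin
    leadingMinor (suc m) (λ r c → M r (punchInℕ (suc i) c))
      ≈⟨ leadingMinor-expand m (λ r c → M r (punchInℕ (suc i) c)) ⟩
    sumℕ (suc m) term
      ≈⟨ sumℕ-single (suc m) {term} 0 z<s term≈0 ⟩
    1# * (M 0 0 * leadingMinor m (λ r c → shift 1 M r (punchInℕ i c)))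
      ≈⟨ *-identityˡ _ ⟩
    M 0 0 * leadingMinor m (λ r c → shift 1 M r (punchInℕ i c))
      ≈⟨ *-cong (diagonal 0) (leadingMinor-deleteColumn (shift 1 M) (shift-isUpperTriangular 1 M-triangular) i m i≤m) ⟩
    d * (d ^ i * blockMinor (shift 1 M) i m)
      ≈⟨ *-assoc d (d ^ i) _ ⟨
    d ^ suc i * blockMinor M (suc i) (suc m)
      ∎
    where
    open IsUpperTriangular M-triangular
    minor : ℕ → Matrix
    minor j r c = M (suc r) (punchInℕ (suc i) (punchInℕ j c))
    term : ℕ → Carrier
    term j = (- 1#) ^ j * (M 0 (punchInℕ (suc i) j) * leadingMinor m (minor j))
    term≈0 : ∀ j → j < suc m → j ≢ 0 → term j ≈ 0#
    term≈0 zero    _         0≢0 = ⊥-elim (0≢0 ≡.refl)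
    term≈0 (suc j) (s≤s j<m) _   = trans (*-congˡ (trans (*-congˡ minor≈0) (zeroʳ _))) (zeroʳ _)
      where
      minor≈0 : leadingMinor m (minor (suc j)) ≈ 0#
      minor≈0 = leadingMinor-zeroColumn m (minor (suc j)) (ℕ.≤-trans z<s j<m) (λ r → upper z<s)

  border : (ℕ → Carrier) → Matrix → Matrix
  border v M zero    c = v c
  border v M (suc r) c = M r c

  module CramerRule {d : Carrier} {M : Matrix} (M-triangular : IsUpperTriangular d M) where
    open IsUpperTriangular M-triangular

    blockMinor-expand : ∀ j m → let k = suc (j ℕ.+ m) in
      blockMinor M j k ≈
      sumℕ (suc m) (λ i → (- 1#) ^ i * (M j (suc (j ℕ.+ i)) * (d ^ i * blockMinor M (suc (j ℕ.+ i)) k)))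
    blockMinor-expand j m = begin
      blockMinor M j k
        ≡⟨ ≡.cong (λ n → leadingMinor n G) size ⟩
      leadingMinor (suc m) G
        ≈⟨ leadingMinor-expand m G ⟩
      sumℕ (suc m) expansion
        ≈⟨ sumℕ-cong (suc m) {expansion} (λ i i<1+m →
             *-congˡ (*-cong (reflexive (≡.cong (λ l → M l (suc (j ℕ.+ i))) (ℕ.+-identityʳ j)))
                             (minor≈ i (ℕ.≤-pred i<1+m)))) ⟩
      sumℕ (suc m) (λ i → (- 1#) ^ i * (M j (suc (j ℕ.+ i)) * (d ^ i * blockMinor M (suc (j ℕ.+ i)) k)))
        ∎
      where
      k = suc (j ℕ.+ m)
      G : Matrix
      G r c = M (j ℕ.+ r) (suc (j ℕ.+ c))
      expansion : ℕ → Carrier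
      expansion i = (- 1#) ^ i * (G 0 i * leadingMinor m (λ r c → G (suc r) (punchInℕ i c)))
      size : k ∸ j ≡ suc m
      size = ≡.trans (≡.cong (_∸ j) (≡.sym (ℕ.+-suc j m))) (ℕ.m+n∸m≡n j (suc m))
      minor≈ : ∀ i → i ≤ m →
               leadingMinor m (λ r c → G (suc r) (punchInℕ i c)) ≈ d ^ i * blockMinor M (suc (j ℕ.+ i)) k
      minor≈ i i≤m = begin
        leadingMinor m (λ r c → G (suc r) (punchInℕ i c))
          ≈⟨ leadingMinor-cong m (λ r c →
               reflexive (≡.cong (λ l → M l (suc (j ℕ.+ punchInℕ i c))) (ℕ.+-suc j r))) ⟩
        leadingMinor m (λ r c → shift (suc j) M r (punchInℕ i c))
          ≈⟨ leadingMinor-deleteColumn (shift (suc j) M) (shift-isUpperTriangular (suc j) M-triangular) i m i≤m ⟩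
        d ^ i * blockMinor (shift (suc j) M) i m
          ≈⟨ *-congˡ (blockMinor-shift (suc j) M i m) ⟩
        d ^ i * blockMinor M (suc (j ℕ.+ i)) k
          ∎

    -- (−1)^k times the (j, k) entry of the adjugate of the leading (k+1) × (k+1) block of M
    cofactor : Matrix
    cofactor j k with j ≤? k
    ... | yes _ = (- 1#) ^ j * (d ^ j * blockMinor M j k)
    ... | no  _ = 0#

    cofactor-≤ : ∀ {j k} → j ≤ k → cofactor j k ≈ (- 1#) ^ j * (d ^ j * blockMinor M j k)
    cofactor-≤ {j} {k} j≤k with j ≤? k
    ... | yes _   = refl
    ... | no  j≰k = ⊥-elim (j≰k j≤k)

    cofactor-upperTriangular : UpperTriangular cofactor
    cofactor-upperTriangular {j} {k} k<j with j ≤? k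
    ... | yes j≤k = ⊥-elim (ℕ.<⇒≱ k<j j≤k)
    ... | no  _   = refl

    cofactor-diagonal : ∀ k → cofactor k k ≈ (- 1#) ^ k * d ^ k
    cofactor-diagonal k =
      trans (cofactor-≤ {k} ℕ.≤-refl) (*-congˡ (trans (*-congˡ (blockMinor-diagonal M k)) (*-identityʳ (d ^ k))))

    leadingMinor-border : ∀ v k → leadingMinor (suc k) (border v M) ≈ sumℕ (suc k) (λ j → v j * cofactor j k)
    leadingMinor-border v k = trans (leadingMinor-expand k (border v M)) (sumℕ-cong (suc k) {expansion} term≈)
      where
      expansion : ℕ → Carrier
      expansion j = (- 1#) ^ j * (v j * leadingMinor k (λ r c → M r (punchInℕ j c)))
      term≈ : ∀ j → j < suc k → expansion j ≈ v j * cofactor j k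
      term≈ j j<1+k = begin
        (- 1#) ^ j * (v j * leadingMinor k (λ r c → M r (punchInℕ j c)))
          ≈⟨ *-congˡ (*-congˡ (leadingMinor-deleteColumn M M-triangular j k (ℕ.≤-pred j<1+k))) ⟩
        (- 1#) ^ j * (v j * (d ^ j * blockMinor M j k))
          ≈⟨ x∙yz≈y∙xz ((- 1#) ^ j) (v j) _ ⟩
        v j * ((- 1#) ^ j * (d ^ j * blockMinor M j k))
          ≈⟨ *-congˡ (cofactor-≤ (ℕ.≤-pred j<1+k)) ⟨
        v j * cofactor j k
          ∎

    -- Up to the factor −(−1)^j d^{j+1}, this is the expansion of blockMinor M j k along its first row.
    M*cofactor-tail : ∀ j m → let k = suc (j ℕ.+ m) in
      sumℕ (suc m) (λ i → M j (suc (j ℕ.+ i)) * cofactor (suc (j ℕ.+ i)) k) ≈ - 1# * (d * cofactor j k)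
    M*cofactor-tail j m = begin
      sumℕ (suc m) (λ i → M j (suc (j ℕ.+ i)) * cofactor (suc (j ℕ.+ i)) k)
        ≈⟨ sumℕ-cong (suc m) (λ i i<1+m → term≈ i (ℕ.≤-pred i<1+m)) ⟩
      sumℕ (suc m) (λ i → scale * expansion i)
        ≈⟨ *-distribˡ-sum {suc m} scale (expansion ∘ toℕ) ⟨
      scale * sumℕ (suc m) expansion
        ≈⟨ *-congˡ (blockMinor-expand j m) ⟨
      scale * blockMinor M j k
        ≈⟨ solve 5 (λ n σ d e b → (n ⊕ (σ ⊕ (d ⊕ e))) ⊕ b ⊜ n ⊕ (d ⊕ (σ ⊕ (e ⊕ b))))
                   refl (- 1#) σ d (d ^ j) (blockMinor M j k) ⟩
      - 1# * (d * (σ * (d ^ j * blockMinor M j k)))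
        ≈⟨ *-congˡ (*-congˡ (cofactor-≤ (ℕ.m≤n⇒m≤1+n (ℕ.m≤m+n j m)))) ⟨
      - 1# * (d * cofactor j k)
        ∎
      where
      k = suc (j ℕ.+ m)
      σ = (- 1#) ^ j
      scale = - 1# * (σ * (d * d ^ j))
      expansion : ℕ → Carrier
      expansion i = (- 1#) ^ i * (M j (suc (j ℕ.+ i)) * (d ^ i * blockMinor M (suc (j ℕ.+ i)) k))
      term≈ : ∀ i → i ≤ m → M j (suc (j ℕ.+ i)) * cofactor (suc (j ℕ.+ i)) k ≈ scale * expansion i
      term≈ i i≤m = begin
        a * cofactor (suc (j ℕ.+ i)) k
          ≈⟨ *-congˡ (cofactor-≤ (s≤s (ℕ.+-monoʳ-≤ j i≤m))) ⟩
        a * ((- 1#) ^ suc (j ℕ.+ i) * (d ^ suc (j ℕ.+ i) * b))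
          ≈⟨ *-congˡ (*-cong (*-congˡ (^-homo-* (- 1#) j i)) (*-congʳ (*-congˡ (^-homo-* d j i)))) ⟩
        a * ((- 1# * (σ * (- 1#) ^ i)) * ((d * (d ^ j * d ^ i)) * b))
          ≈⟨ solve 8 (λ a n σ τ d e f b → a ⊕ ((n ⊕ (σ ⊕ τ)) ⊕ ((d ⊕ (e ⊕ f)) ⊕ b))
                                      ⊜ (n ⊕ (σ ⊕ (d ⊕ e))) ⊕ (τ ⊕ (a ⊕ (f ⊕ b))))
                     refl a (- 1#) σ ((- 1#) ^ i) d (d ^ j) (d ^ i) b ⟩
        scale * expansion i
          ∎
        where
        a = M j (suc (j ℕ.+ i))
        b = blockMinor M (suc (j ℕ.+ i)) k

    module _ (N : ℕ) where

      M*cofactor-above : ∀ {j k} → j < k → k ≤ N → matMul N M cofactor j k ≈ 0#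
      M*cofactor-above {j} {k} j<k k≤N with ℕ.m≤n⇒∃[o]m+o≡n j<k
      ... | m , ≡.refl = begin
        sumℕ (suc N) f
          ≈⟨ sumℕ-window j (suc (suc m)) (suc N) {f} fits (λ l l<j → trans (*-congʳ (upper l<j)) (zeroˡ _))
                 (λ l j+2+m≤l → trans (*-congˡ (cofactor-upperTriangular (k<l j+2+m≤l))) (zeroʳ _)) ⟩
        f (j ℕ.+ 0) + sumℕ (suc m) (λ i → f (j ℕ.+ suc i))
          ≈⟨ +-cong head (trans (sumℕ-cong (suc m) (λ i _ → reflexive (≡.cong f (ℕ.+-suc j i))))
                                (M*cofactor-tail j m)) ⟩
        d * cofactor j k + - 1# * (d * cofactor j k)
          ≈⟨ +-congˡ (-1*x≈-x _) ⟩
        d * cofactor j k + - (d * cofactor j k)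
          ≈⟨ -‿inverseʳ _ ⟩
        0#
          ∎
        where
        f : ℕ → Carrier
        f l = M j l * cofactor l k
        j+2+m≡2+k : j ℕ.+ suc (suc m) ≡ suc k
        j+2+m≡2+k = ≡.trans (ℕ.+-suc j (suc m)) (≡.cong suc (ℕ.+-suc j m))
        fits : j ℕ.+ suc (suc m) ≤ suc N
        fits = ≡.subst (_≤ suc N) (≡.sym j+2+m≡2+k) (s≤s k≤N)
        k<l : ∀ {l} → j ℕ.+ suc (suc m) ≤ l → k < l
        k<l {l} = ≡.subst (_≤ l) j+2+m≡2+k
        head : f (j ℕ.+ 0) ≈ d * cofactor j k
        head = trans (reflexive (≡.cong f (ℕ.+-identityʳ j))) (*-congʳ (diagonal j))

      M*cofactor-below : ∀ {j k} → k < j → matMul N M cofactor j k ≈ 0#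
      M*cofactor-below {j} {k} k<j = sumℕ-zero (suc N) term≈0
        where
        term≈0 : ∀ l → l < suc N → M j l * cofactor l k ≈ 0#
        term≈0 l _ with l ℕ.<? j
        ... | yes l<j = trans (*-congʳ (upper l<j)) (zeroˡ _)
        ... | no  l≮j = trans (*-congˡ (cofactor-upperTriangular (ℕ.<-≤-trans k<j (ℕ.≮⇒≥ l≮j)))) (zeroʳ _)

      M*cofactor-diagonal : ∀ {k} → k ≤ N → matMul N M cofactor k k ≈ d * cofactor k k
      M*cofactor-diagonal {k} k≤N =
        trans (sumℕ-single (suc N) {λ l → M k l * cofactor l k} k (s≤s k≤N) off-diagonal) (*-congʳ (diagonal k))
        where
        off-diagonal : ∀ l → l < suc N → l ≢ k → M k l * cofactor l k ≈ 0#
        off-diagonal l _ l≢k with ℕ.<-cmp l k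
        ... | tri< l<k _ _ = trans (*-congʳ (upper l<k)) (zeroˡ _)
        ... | tri≈ _ l≡k _ = ⊥-elim (l≢k l≡k)
        ... | tri> _ _ k<l = trans (*-congˡ (cofactor-upperTriangular k<l)) (zeroʳ _)

      vecMul-M*cofactor : ∀ a {m} → m ≤ N → vecMul N a (matMul N M cofactor) m ≈ a m * (d * cofactor m m)
      vecMul-M*cofactor a {m} m≤N =
        trans (sumℕ-single (suc N) {λ k → a k * matMul N M cofactor k m} m (s≤s m≤N) off-diagonal)
              (*-congˡ (M*cofactor-diagonal m≤N))
        where
        off-diagonal : ∀ k → k < suc N → k ≢ m → a k * matMul N M cofactor k m ≈ 0#
        off-diagonal k _ k≢m with ℕ.<-cmp k m
        ... | tri< k<m _ _ = trans (*-congˡ (M*cofactor-above k<m m≤N)) (zeroʳ (a k))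
        ... | tri≈ _ k≡m _ = ⊥-elim (k≢m k≡m)
        ... | tri> _ _ m<k = trans (*-congˡ (M*cofactor-below m<k)) (zeroʳ (a k))

    -- Cramer's rule for the last unknown of the (k+1) × (k+1) system a M = v: row k of M is
    -- replaced by v (moved to the top, whence (−1)^k) and the determinant is divided by d^{k+1}.
    cramerSolution : (ℕ → Carrier) → ℕ → Carrier
    cramerSolution v k = (- 1#) ^ k * (leadingMinor (suc k) (border v M) * (d ^ suc k) ⁻¹)

    module _ (d≉0 : ¬ (d ≈ 0#)) (v : ℕ → Carrier) where

      cofactor-diagonal≉0 : ∀ k → ¬ (cofactor k k ≈ 0#)
      cofactor-diagonal≉0 k kk≈0 =
        x≉0∧y≉0⇒xy≉0 ([-1]^n≉0 k) (x^n≉0 d≉0 k) (trans (sym (cofactor-diagonal k)) kk≈0)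

      cramerSolution*diagonal : ∀ m → cramerSolution v m * (d * cofactor m m) ≈ sumℕ (suc m) (λ n → v n * cofactor n m)
      cramerSolution*diagonal m = begin
        σ * (leadingMinor (suc m) (border v M) * p ⁻¹) * (d * cofactor m m)
          ≈⟨ *-cong (*-congˡ (*-congʳ (leadingMinor-border v m))) (*-congˡ (cofactor-diagonal m)) ⟩
        σ * (S * p ⁻¹) * (d * (σ * d ^ m))
          ≈⟨ solve 5 (λ σ S p⁻¹ d e → (σ ⊕ (S ⊕ p⁻¹)) ⊕ (d ⊕ (σ ⊕ e))
                                    ⊜ S ⊕ ((σ ⊕ σ) ⊕ ((d ⊕ e) ⊕ p⁻¹)))
                     refl σ S (p ⁻¹) d (d ^ m) ⟩
        S * ((σ * σ) * (p * p ⁻¹))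
          ≈⟨ *-congˡ (*-cong ([-1]^n*[-1]^n≈1 m) (⁻¹-inverse p (x^n≉0 d≉0 (suc m)))) ⟩
        S * (1# * 1#)
          ≈⟨ *-congˡ (*-identityʳ 1#) ⟩
        S * 1#
          ≈⟨ *-identityʳ S ⟩
        S
          ∎
        where
        σ = (- 1#) ^ m
        p = d ^ suc m
        S = sumℕ (suc m) (λ n → v n * cofactor n m)

      cramerSolution-solves : ∀ N → vecMul N (cramerSolution v) M N ≈ v N
      cramerSolution-solves N =
        uT≈vT⇒u≈v N cofactor-upperTriangular cofactor-diagonal≉0 (vecMul N a M) v aMY≈vY N ℕ.≤-refl
        where
        a = cramerSolution v
        aMY≈vY : ∀ m → m ≤ N → vecMul N (vecMul N a M) cofactor m ≈ vecMul N v cofactor m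
        aMY≈vY m m≤N = begin
          vecMul N (vecMul N a M) cofactor m
            ≈⟨ vecMul-assoc N a M cofactor m ⟩
          vecMul N a (matMul N M cofactor) m
            ≈⟨ vecMul-M*cofactor N a m≤N ⟩
          a m * (d * cofactor m m)
            ≈⟨ cramerSolution*diagonal m ⟩
          sumℕ (suc m) (λ n → v n * cofactor n m)
            ≈⟨ sumℕ-window 0 (suc m) (suc N) {λ n → v n * cofactor n m} (s≤s m≤N) (λ _ ())
                 (λ n m<n → trans (*-congˡ (cofactor-upperTriangular m<n)) (zeroʳ _)) ⟨
          vecMul N v cofactor m
            ∎

module QBinomialSystem {c ℓ₁ ℓ₂ : Level} (F : OrderedField c ℓ₁ ℓ₂) where
  open OrderedField F hiding (zero) renaming (_<_ to _<ᶠ_)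
  open OrderedFieldProperties F
  open UpperTriangularSystems F
  open SetoidReasoning setoid

  qBinomialMatrix : Carrier → (ℕ → Carrier) → Matrix
  qBinomialMatrix q B r c with r ≤? c
  ... | yes _ = qBinom F q c r * B (c ∸ r)
  ... | no  _ = 0#

  qBinomialMatrix-≤ : ∀ q B {r c} → r ≤ c → qBinomialMatrix q B r c ≈ qBinom F q c r * B (c ∸ r)
  qBinomialMatrix-≤ q B {r} {c} r≤c with r ≤? c
  ... | yes _   = refl
  ... | no  r≰c = ⊥-elim (r≰c r≤c)

  qBinomialMatrix-isUpperTriangular : ∀ {q} → 0# <ᶠ q → q <ᶠ 1# → ∀ B →
                                      IsUpperTriangular (B 0) (qBinomialMatrix q B)
  qBinomialMatrix-isUpperTriangular {q} 0<q q<1 B = record { upper = upper ; diagonal = diagonal }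
    where
    upper : UpperTriangular (qBinomialMatrix q B)
    upper {r} {c} c<r with r ≤? c
    ... | yes r≤c = ⊥-elim (ℕ.<⇒≱ c<r r≤c)
    ... | no  _   = refl
    diagonal : ∀ r → qBinomialMatrix q B r r ≈ B 0
    diagonal r = begin
      qBinomialMatrix q B r r      ≈⟨ qBinomialMatrix-≤ q B {r} ℕ.≤-refl ⟩
      qBinom F q r r * B (r ∸ r)   ≈⟨ *-cong (qBinom-diag 0<q q<1 r) (reflexive (≡.cong B (ℕ.n∸n≡0 r))) ⟩
      1# * B 0                     ≈⟨ *-identityˡ (B 0) ⟩
      B 0                          ∎

  NMat≡border : ∀ q B x n (r c : Fin (suc n)) →
    NMat F q B x n r c ≡ border (x ^_) (qBinomialMatrix q B) (toℕ r) (toℕ c)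
  NMat≡border q B x n zero    c = ≡.refl
  NMat≡border q B x n (suc r) c with toℕ r ≤? toℕ c
  ... | yes _ = ≡.refl
  ... | no  _ = ≡.refl

  module _ {q : Carrier} (0<q : 0# <ᶠ q) (q<1 : q <ᶠ 1#) (B : ℕ → Carrier) (B0≉0 : ¬ (B 0 ≈ 0#)) (x : Carrier) where
    open CramerRule (qBinomialMatrix-isUpperTriangular 0<q q<1 B)

    Apoly≈cramerSolution : ∀ k → Apoly F q B x k ≈ cramerSolution (x ^_) k
    Apoly≈cramerSolution zero = begin
      B 0 ⁻¹
        ≈⟨ ⁻¹-cong (x≉0∧y≉0⇒xy≉0 B0≉0 1≉0) (sym (*-identityʳ (B 0))) ⟩
      (B 0 * 1#) ⁻¹
        ≈⟨ *-identityˡ _ ⟨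
      1# * (B 0 * 1#) ⁻¹
        ≈⟨ *-congʳ detN₀≈1 ⟨
      leadingMinor 1 (border (x ^_) R) * (B 0 * 1#) ⁻¹
        ≈⟨ *-identityˡ _ ⟨
      cramerSolution (x ^_) 0
        ∎
      where
      R = qBinomialMatrix q B
      detN₀≈1 : leadingMinor 1 (border (x ^_) R) ≈ 1#
      detN₀≈1 = trans (+-identityʳ _) (trans (*-identityˡ _) (*-identityˡ _))
    Apoly≈cramerSolution (suc k) =
      *-congˡ (*-congʳ (det-cong (suc (suc k)) (λ r c → reflexive (NMat≡border q B x (suc k) r c))))

mainTheorem8 : ∀ {c ℓ₁ ℓ₂ : Level} (F : OrderedField c ℓ₁ ℓ₂) →
    let open OrderedField F in
    (q : Carrier) → 0# < q → q < 1# →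
    (B : ℕ → Carrier) → ¬ (B 0 ≈ 0#) →
    (x : Carrier) (n : ℕ) → 1 ≤ n →
    pow F x n ≈ sumFin F (suc n) (λ k →
    qBinom F q n (toℕ k) * B (n ∸ toℕ k) * Apoly F q B x (toℕ k))
-- The identity also holds for n = 0.
mainTheorem8 F q 0<q q<1 B B0≉0 x n _ = begin
    pow F x n
      ≈⟨ cramerSolution-solves B0≉0 (pow F x) n ⟨
    vecMul n (cramerSolution (pow F x)) R n
      ≈⟨ sumℕ-cong (suc n) (λ k k<1+n → trans (*-comm _ _)
           (*-cong (qBinomialMatrix-≤ q B (ℕ.≤-pred k<1+n)) (sym (Apoly≈cramerSolution 0<q q<1 B B0≉0 x k)))) ⟩
    sumℕ (suc n) (λ k → qBinom F q n k * B (n ∸ k) * Apoly F q B x k)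
      ≡⟨ sumFin≡sum (suc n) (λ k → qBinom F q n (toℕ k) * B (n ∸ toℕ k) * Apoly F q B x (toℕ k)) ⟨
    sumFin F (suc n) (λ k → qBinom F q n (toℕ k) * B (n ∸ toℕ k) * Apoly F q B x (toℕ k))
      ∎
  where
  open OrderedField F using (setoid; _*_; *-comm; *-cong; sym; trans)
  open SetoidReasoning setoid
  open UpperTriangularSystems F
  open QBinomialSystem F
  R = qBinomialMatrix q B
  open CramerRule (qBinomialMatrix-isUpperTriangular 0<q q<1 B)
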